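{- Let $p$ be a prime. For every pair $d,m$ of positive integers there is a $\mathrm{pReLU}$-network of width $d$ (input dimension $1$, output dimension $d$) which computes, on $\mathbb Z_p$, a decoding function of type $(d,m)$.
   Context: $\mathbb Q_p$ denotes the $p$-adic numbers and $\mathbb Z_p$ the $p$-adic integers. A decoding function of type $(d,m)$ is a function $f:\mathbb Z_p\to\mathbb Z_p^d$ such that for every $y\in\mathbb Z_p^d$ there is an $x\in\mathbb Z_p$ with $y-f(x)\in p^m\mathbb Z_p^d$. The function $\mathrm{pReLU}:\mathbb Q_p\to\mathbb Q_p$ is defined by $\mathrm{pReLU}(x)=x$ if $x\in\mathbb Z_p$ and $0$ otherwise. A $\mathrm{pReLU}$-network with input dimension $d_x$, output dimension $d_y$ and hidden layer dimensions $d_1,\dots,d_{L-1}$ is a composition $t_L\circ\Sigma_{L-1}\circ t_{L-1}\circ\cdots\circ t_2\circ\Sigma_1\circ t_1:\mathbb Q_p^{d_x}\to\mathbb Q_p^{d_y}$, where (with $d_0=d_x$, $d_L=d_y$) each $t_l:\mathbb Q_p^{d_{l-1}}\to\mathbb Q_p^{d_l}$ is an affine map with coefficients in $\mathbb Q_p$ and $\Sigma_l$ applies $\mathrm{pReLU}$ to each coordinate. Its width is $\max(d_1,\dots,d_{L-1})$. A network computes a function on a set $X$ if its restriction to $X$ equals that function. -}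

module Defs where

open import Data.Nat using (ℕ; zero; suc; _+_; _*_; _∸_; _^_; _⊔_; NonZero; _≡ᵇ_)
open import Data.Nat.Properties using (m^n≢0)
open import Data.Nat.DivMod using (_/_; _mod_)
open import Data.Fin using (Fin; toℕ)
open import Data.Bool using (if_then_else_)
open import Data.Product using (Σ; ∃; _×_)
open import Relation.Binary.PropositionalEquality using (_≡_)

module Padic (p : ℕ) .{{p≢0 : NonZero p}} where

  -- ℤ_p : p-adic digit expansions  x = Σ_i x(i) p^i
  ℤp : Set
  ℤp = ℕ → Fin p

  -- equality in ℤ_p (digit expansions are unique)
  _≈_ : ℤp → ℤp → Set
  x ≈ y = ∀ n → x n ≡ y n

  res : ℤp → ℕ → ℕ
  res x zero    = 0
  res x (suc n) = res x n + toℕ (x n) * p ^ n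

  -- the p-adic integer whose residue mod p^(n) is s n (mod p^n);
  -- digit n = ⌊ s(n+1) / p^n ⌋ mod p
  digits : (ℕ → ℕ) → ℤp
  digits s n = (_/_ (s (suc n)) (p ^ n) {{m^n≢0 p n}}) mod p

  fromℕ : ℕ → ℤp
  fromℕ k = digits (λ _ → k)

  0ℤ : ℤp
  0ℤ = fromℕ 0

  _+ℤ_ : ℤp → ℤp → ℤp
  x +ℤ y = digits (λ n → res x n + res y n)

  _*ℤ_ : ℤp → ℤp → ℤp
  x *ℤ y = digits (λ n → res x n * res y n)

  -ℤ_ : ℤp → ℤp
  -ℤ x = digits (λ n → p ^ n ∸ res x n)

  _-ℤ_ : ℤp → ℤp → ℤp
  x -ℤ y = x +ℤ (-ℤ y)

  -- division by p^e of an element divisible by p^e (drop e digits)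
  shiftL : ℕ → ℤp → ℤp
  shiftL e x i = x (i + e)

  -- ℚ_p : elements u / p^e with u ∈ ℤ_p
  record ℚp : Set where
    constructor _/p^_
    field
      num : ℤp
      exp : ℕ
  open ℚp public

  _≈Q_ : ℚp → ℚp → Set
  (u /p^ e) ≈Q (v /p^ f) = (fromℕ (p ^ f) *ℤ u) ≈ (fromℕ (p ^ e) *ℤ v)

  ι : ℤp → ℚp
  ι x = x /p^ 0

  0Q : ℚp
  0Q = ι 0ℤ

  _+Q_ : ℚp → ℚp → ℚp
  (u /p^ e) +Q (v /p^ f) = ((fromℕ (p ^ f) *ℤ u) +ℤ (fromℕ (p ^ e) *ℤ v)) /p^ (e + f)

  _*Q_ : ℚp → ℚp → ℚp
  (u /p^ e) *Q (v /p^ f) = (u *ℤ v) /p^ (e + f)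

  -- pReLU(x) = x if x ∈ ℤ_p, and 0 otherwise.
  -- u / p^e ∈ ℤ_p  iff  p^e ∣ u  iff  res u e = 0.
  pReLU : ℚp → ℚp
  pReLU (u /p^ e) = if res u e ≡ᵇ 0 then ι (shiftL e u) else 0Q

  sumQ : (n : ℕ) → (Fin n → ℚp) → ℚp
  sumQ zero    f = 0Q
  sumQ (suc n) f = f Fin.zero +Q sumQ n (λ i → f (Fin.suc i))

  record Affine (a b : ℕ) : Set where
    constructor affine
    field
      W : Fin b → Fin a → ℚp
      c : Fin b → ℚp

  applyAff : ∀ {a b} → Affine a b → (Fin a → ℚp) → (Fin b → ℚp)
  applyAff {a} (affine W c) x i = sumQ a (λ j → W i j *Q x j) +Q c i

  -- pReLU-networks  t_L ∘ Σ_{L-1} ∘ t_{L-1} ∘ ⋯ ∘ Σ_1 ∘ t_1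
  data Net : ℕ → ℕ → Set where
    output : ∀ {a b} → Affine a b → Net a b
    hidden : ∀ {a c b} → Affine a c → Net c b → Net a b

  eval : ∀ {a b} → Net a b → (Fin a → ℚp) → (Fin b → ℚp)
  eval (output t)   x = applyAff t x
  eval (hidden t N) x = eval N (λ i → pReLU (applyAff t x i))

  width : ∀ {a b} → Net a b → ℕ
  width (output t)           = 0
  width (hidden {c = c} t N) = c ⊔ width N

  IsDecoding : (d m : ℕ) → (ℤp → Fin d → ℤp) → Set
  IsDecoding d m f =
    ∀ (y : Fin d → ℤp) → ∃ λ (x : ℤp) →
      ∀ i → ∃ λ (z : ℤp) → (y i -ℤ f x i) ≈ (fromℕ (p ^ m) *ℤ z)

  Computes : ∀ {d} → Net 1 d → (ℤp → Fin d → ℤp) → Set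
  Computes N f = ∀ (x : ℤp) i → eval N (λ _ → ι x) i ≈Q ι (f x i)

-- On input p^J the network copies its input to d coordinates, and every hidden layer divides each
-- coordinate by p and adds an integral bias.  A coordinate stays integral for J layers; the next
-- layer makes it ≡ 1/p modulo ℤ_p, so pReLU resets it to 0.  Each of the remaining s layers then
-- adds its bias exactly, so the output is a sum of s biases, which by the choice of biases is
-- ≡ the i-th base-p^m digit of s - 1 modulo p^m.  As J runs over 1, …, p^(md), the number s - 1
-- runs over 0, …, p^(md) - 1, so every residue vector modulo p^m is attained.  On such inputs every
-- value in the network is a natural number divided by a power of p, which is how it is computed.
module Submission where

open import Defs
open import Data.Bool using (true; false)
open import Data.Fin using (Fin; toℕ; zero; suc)
open import Data.Fin.Properties using (toℕ<n; toℕ-fromℕ<; toℕ-injective)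
open import Data.Nat
  using (ℕ; zero; suc; _+_; _*_; _∸_; _^_; _≤_; _<_; _⊔_; _≡ᵇ_; z≤n; s≤s)
open import Data.Nat.Base using (NonZero; >-nonZero⁻¹; nonTrivial⇒n>1)
open import Data.Nat.DivMod
open import Data.Nat.Divisibility using (m∣m*n; n∣m*n)
open import Data.Nat.Primality using (Prime; prime⇒nonZero; prime⇒nonTrivial)
open import Data.Nat.Properties
open import Data.Nat.Solver using (module +-*-Solver)
open import Data.Product using (∃; _×_; _,_; proj₁; proj₂)
open import Relation.Binary.PropositionalEquality
  using (_≡_; _≢_; refl; sym; trans; cong; cong₂; subst; module ≡-Reasoning)
open import Relation.Nullary using (contradiction)
open +-*-Solver using (solve; _:+_; _:*_; _:=_; con)

module PadicResidues (p : ℕ) .{{p≢0 : NonZero p}} where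
  open Padic p

  infixl 7 _%p^_
  _%p^_ : ℕ → ℕ → ℕ
  a %p^ n = _%_ a (p ^ n) {{m^n≢0 p n}}

  infix 4 _≈ℕ_
  _≈ℕ_ : ℤp → ℕ → Set
  x ≈ℕ a = ∀ n → res x n ≡ a %p^ n

  res<p^ : ∀ x n → res x n < p ^ n
  res<p^ x zero    = s≤s z≤n
  res<p^ x (suc n) = begin-strict
      res x n + toℕ (x n) * p ^ n  <⟨ +-monoˡ-< (toℕ (x n) * p ^ n) (res<p^ x n) ⟩
      p ^ n + toℕ (x n) * p ^ n    ≤⟨ *-monoˡ-≤ (p ^ n) (toℕ<n (x n)) ⟩
      p * p ^ n                    ∎
    where open ≤-Reasoning

  res%p^ : ∀ x n → res x n %p^ n ≡ res x n
  res%p^ x n = m<n⇒m%n≡m {{m^n≢0 p n}} (res<p^ x n)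

  res-shiftL : ∀ x e n → res x (n + e) ≡ res x e + p ^ e * res (shiftL e x) n
  res-shiftL x e zero    = sym (trans (cong (res x e +_) (*-zeroʳ (p ^ e))) (+-identityʳ (res x e)))
  res-shiftL x e (suc n) = begin
      res x (n + e) + xₙ * p ^ (n + e)
        ≡⟨ cong₂ (λ a b → a + xₙ * b) (res-shiftL x e n)
                 (trans (^-distribˡ-+-* p n e) (*-comm (p ^ n) (p ^ e))) ⟩
      res x e + p ^ e * res (shiftL e x) n + xₙ * (p ^ e * p ^ n)
        ≡⟨ solve 5 (λ a b c t q → a :+ b :* c :+ t :* (b :* q) := a :+ b :* (c :+ t :* q)) refl
             (res x e) (p ^ e) (res (shiftL e x) n) xₙ (p ^ n) ⟩
      res x e + p ^ e * (res (shiftL e x) n + xₙ * p ^ n) ∎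
    where open ≡-Reasoning
          xₙ = toℕ (x (n + e))

  res-prefix : ∀ x n k → res x (k + n) %p^ n ≡ res x n
  res-prefix x n k = begin
      res x (k + n) %p^ n                           ≡⟨ cong (_%p^ n) (res-shiftL x n k) ⟩
      (res x n + p ^ n * res (shiftL n x) k) %p^ n  ≡⟨ %-remove-+ʳ (res x n) {d = p ^ n} (m∣m*n _) ⟩
      res x n %p^ n                                 ≡⟨ res%p^ x n ⟩
      res x n                                       ∎
    where open ≡-Reasoning
          instance _ = m^n≢0 p n

  res-injective : ∀ {x y} → (∀ n → res x n ≡ res y n) → x ≈ y
  res-injective {x} {y} eq n =
    toℕ-injective (*-cancelʳ-≡ (toℕ (x n)) (toℕ (y n)) (p ^ n) {{m^n≢0 p n}}
      (+-cancelˡ-≡ (res x n) _ _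
        (trans (eq (suc n)) (cong (λ r → r + toℕ (y n) * p ^ n) (sym (eq n))))))

  %p^-suc : ∀ a n → a %p^ suc n ≡ a %p^ n + (_/_ a (p ^ n) {{m^n≢0 p n}} % p) * p ^ n
  %p^-suc a n = begin
      a % (p * p ^ n)
        ≡⟨ m≡m%n+[m/n]*n (a % (p * p ^ n)) (p ^ n) ⟩
      a % (p * p ^ n) % p ^ n + a % (p * p ^ n) / p ^ n * p ^ n
        ≡⟨ cong₂ (λ u v → u + v * p ^ n) (m∣n⇒o%n%m≡o%m (p ^ n) (p * p ^ n) a (n∣m*n p))
                                          (m%[n*o]/o≡m/o%n a p (p ^ n)) ⟩
      a % p ^ n + (a / p ^ n % p) * p ^ n ∎
    where open ≡-Reasoning
          instance _ = m^n≢0 p n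
                   _ = m^n≢0 p (suc n)

  Coherent : (ℕ → ℕ) → Set
  Coherent s = ∀ n → s (suc n) %p^ n ≡ s n %p^ n

  res-digits : ∀ {s} → Coherent s → ∀ n → res (digits s) n ≡ s n %p^ n
  res-digits {s} coh zero    = sym (n%1≡0 (s 0))
  res-digits {s} coh (suc n) = begin
      res (digits s) n + toℕ (digits s n) * p ^ n
        ≡⟨ cong₂ (λ u v → u + v * p ^ n) (trans (res-digits coh n) (sym (coh n)))
                                          (toℕ-fromℕ< (m%n<n (_/_ (s (suc n)) (p ^ n) {{m^n≢0 p n}}) p)) ⟩
      s (suc n) %p^ n + (_/_ (s (suc n)) (p ^ n) {{m^n≢0 p n}} % p) * p ^ n
        ≡⟨ sym (%p^-suc (s (suc n)) n) ⟩
      s (suc n) %p^ suc n ∎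
    where open ≡-Reasoning

  module _ (_∙_ : ℕ → ℕ → ℕ)
           (%-distrib : ∀ a b k .{{_ : NonZero k}} → (a ∙ b) % k ≡ ((a % k) ∙ (b % k)) % k) where

    res-digitwise : ∀ x y n → res (digits (λ k → res x k ∙ res y k)) n ≡ (res x n ∙ res y n) %p^ n
    res-digitwise x y = res-digits λ n →
      trans (%-distrib (res x (suc n)) (res y (suc n)) (p ^ n) {{m^n≢0 p n}})
            (cong₂ (λ u v → (u ∙ v) %p^ n) (res-prefix x n 1) (res-prefix y n 1))

    digitwise-≈ℕ : ∀ {x y a b} → x ≈ℕ a → y ≈ℕ b → digits (λ k → res x k ∙ res y k) ≈ℕ a ∙ b
    digitwise-≈ℕ {x} {y} {a} {b} x≈a y≈b n = begin
      res (digits (λ k → res x k ∙ res y k)) n  ≡⟨ res-digitwise x y n ⟩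
      (res x n ∙ res y n) %p^ n                 ≡⟨ cong₂ (λ u v → (u ∙ v) %p^ n) (x≈a n) (y≈b n) ⟩
      ((a %p^ n) ∙ (b %p^ n)) %p^ n             ≡⟨ sym (%-distrib a b (p ^ n) {{m^n≢0 p n}}) ⟩
      (a ∙ b) %p^ n                             ∎
      where open ≡-Reasoning

  res-+ℤ : ∀ x y n → res (x +ℤ y) n ≡ (res x n + res y n) %p^ n
  res-+ℤ = res-digitwise _+_ %-distribˡ-+

  res-*ℤ : ∀ x y n → res (x *ℤ y) n ≡ (res x n * res y n) %p^ n
  res-*ℤ = res-digitwise _*_ %-distribˡ-*

  p^∸res-suc : ∀ x n → p ^ suc n ∸ res x (suc n) ≡ (p ^ n ∸ res x n) + (p ∸ suc (toℕ (x n))) * p ^ n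
  p^∸res-suc x n = begin
      p * P ∸ (r + xₙ * P)                  ≡⟨ cong (_∸ (r + xₙ * P)) (sym total) ⟩
      A + (r + xₙ * P) ∸ (r + xₙ * P)       ≡⟨ m+n∸n≡m A (r + xₙ * P) ⟩
      A                                     ∎
    where
      open ≡-Reasoning
      P = p ^ n
      r = res x n
      xₙ = toℕ (x n)
      k = p ∸ suc xₙ
      A = (P ∸ r) + k * P
      total : A + (r + xₙ * P) ≡ p * P
      total = begin
          (P ∸ r) + k * P + (r + xₙ * P)
            ≡⟨ solve 5 (λ A K P r d → A :+ K :* P :+ (r :+ d :* P) := (A :+ r) :+ (d :+ K) :* P) refl
                 (P ∸ r) k P r xₙ ⟩
          (P ∸ r) + r + (xₙ + k) * P  ≡⟨ cong (_+ (xₙ + k) * P) (m∸n+n≡m (<⇒≤ (res<p^ x n))) ⟩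
          suc (xₙ + k) * P            ≡⟨ cong (_* P) (m+[n∸m]≡n (toℕ<n (x n))) ⟩
          p * P                       ∎

  res-negate : ∀ x n → res (-ℤ x) n ≡ (p ^ n ∸ res x n) %p^ n
  res-negate x = res-digits λ n →
    trans (cong (_%p^ n) (p^∸res-suc x n))
          ([m+kn]%n≡m%n (p ^ n ∸ res x n) (p ∸ suc (toℕ (x n))) (p ^ n) {{m^n≢0 p n}})

  fromℕ-≈ℕ : ∀ a → fromℕ a ≈ℕ a
  fromℕ-≈ℕ a = res-digits λ _ → refl

  +ℤ-≈ℕ : ∀ {x y a b} → x ≈ℕ a → y ≈ℕ b → (x +ℤ y) ≈ℕ a + b
  +ℤ-≈ℕ = digitwise-≈ℕ _+_ %-distribˡ-+

  *ℤ-≈ℕ : ∀ {x y a b} → x ≈ℕ a → y ≈ℕ b → (x *ℤ y) ≈ℕ a * b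
  *ℤ-≈ℕ = digitwise-≈ℕ _*_ %-distribˡ-*

  shiftL-≈ℕ : ∀ {x} b e → x ≈ℕ b * p ^ e → shiftL e x ≈ℕ b
  shiftL-≈ℕ {x} b e x≈ n = *-cancelˡ-≡ _ _ (p ^ e) (begin
      p ^ e * res (shiftL e x) n            ≡⟨ cong (_+ p ^ e * res (shiftL e x) n) (sym res-e≡0) ⟩
      res x e + p ^ e * res (shiftL e x) n  ≡⟨ sym (res-shiftL x e n) ⟩
      res x (n + e)                         ≡⟨ x≈ (n + e) ⟩
      b * p ^ e % p ^ (n + e)               ≡⟨ %-congʳ (^-distribˡ-+-* p n e) ⟩
      b * p ^ e % (p ^ n * p ^ e)           ≡⟨ sym (m%n*o≡m*o%[n*o] b (p ^ n) (p ^ e)) ⟩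
      b % p ^ n * p ^ e                     ≡⟨ *-comm _ (p ^ e) ⟩
      p ^ e * (b % p ^ n)                   ∎)
    where
      open ≡-Reasoning
      instance _ = m^n≢0 p e
               _ = m^n≢0 p n
               _ = m^n≢0 p (n + e)
               _ = m*n≢0 (p ^ n) (p ^ e)
      res-e≡0 : res x e ≡ 0
      res-e≡0 = trans (x≈ e) (m*n%n≡0 b (p ^ e))

  res≡0⇒≈p^*shiftL : ∀ w m → res w m ≡ 0 → w ≈ (fromℕ (p ^ m) *ℤ shiftL m w)
  res≡0⇒≈p^*shiftL w m w≡0 = res-injective λ n → begin
      res w n                                  ≡⟨ sym (res-prefix w n m) ⟩
      res w (m + n) %p^ n                      ≡⟨ cong (λ k → res w k %p^ n) (+-comm m n) ⟩
      res w (n + m) %p^ n                      ≡⟨ cong (_%p^ n) (res-shiftL w m n) ⟩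
      (res w m + p ^ m * res s n) %p^ n        ≡⟨ cong (λ r → (r + p ^ m * res s n) %p^ n) w≡0 ⟩
      (p ^ m * res s n) %p^ n                  ≡⟨ %-distribˡ-* (p ^ m) (res s n) (p ^ n) {{m^n≢0 p n}} ⟩
      ((p ^ m %p^ n) * (res s n %p^ n)) %p^ n
        ≡⟨ cong₂ (λ u v → (u * v) %p^ n) (sym (fromℕ-≈ℕ (p ^ m) n)) (res%p^ s n) ⟩
      (res (fromℕ (p ^ m)) n * res s n) %p^ n  ≡⟨ sym (res-*ℤ (fromℕ (p ^ m)) s n) ⟩
      res (fromℕ (p ^ m) *ℤ s) n               ∎
    where open ≡-Reasoning
          s = shiftL m w

  res-ℤ≡0 : ∀ y w n → res y n ≡ res w n → res (y -ℤ w) n ≡ 0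
  res-ℤ≡0 y w n eq = begin
      res (y -ℤ w) n                          ≡⟨ res-+ℤ y (-ℤ w) n ⟩
      (res y n + res (-ℤ w) n) %p^ n          ≡⟨ cong₂ (λ u v → (u + v) %p^ n)
                                                       (trans (sym (res%p^ y n)) (cong (_%p^ n) eq))
                                                       (res-negate w n) ⟩
      (r %p^ n + (p ^ n ∸ r) %p^ n) %p^ n     ≡⟨ sym (%-distribˡ-+ r (p ^ n ∸ r) (p ^ n)) ⟩
      (r + (p ^ n ∸ r)) %p^ n                 ≡⟨ cong (_%p^ n) (m+[n∸m]≡n (<⇒≤ (res<p^ w n))) ⟩
      p ^ n %p^ n                             ≡⟨ n%n≡0 (p ^ n) ⟩
      0                                       ∎
    where open ≡-Reasoning
          r = res w n
          instance _ = m^n≢0 p n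

  res≡⇒p^∣-ℤ : ∀ {y w} m → res y m ≡ res w m → ∃ λ z → (y -ℤ w) ≈ (fromℕ (p ^ m) *ℤ z)
  res≡⇒p^∣-ℤ {y} {w} m eq = shiftL m (y -ℤ w) , res≡0⇒≈p^*shiftL (y -ℤ w) m (res-ℤ≡0 y w m eq)

  res-surjective⇒IsDecoding : ∀ d m (f : ℤp → Fin d → ℤp) →
                              (∀ y → ∃ λ x → ∀ i → res (y i) m ≡ res (f x i) m) → IsDecoding d m f
  res-surjective⇒IsDecoding d m f hits y = proj₁ (hits y) , λ i → res≡⇒p^∣-ℤ m (proj₂ (hits y) i)

module PadicFractions (p : ℕ) .{{p≢0 : NonZero p}} where
  open Padic p
  open PadicResidues p

  infix 4 _≐_/p^_
  _≐_/p^_ : ℚp → ℕ → ℕ → Set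
  u ≐ a /p^ e = exp u ≡ e × num u ≈ℕ a

  ≐-cong : ∀ {u a b e f} → a ≡ b → e ≡ f → u ≐ a /p^ e → u ≐ b /p^ f
  ≐-cong refl refl u≐ = u≐

  ι-≐ : ∀ {x a} → x ≈ℕ a → ι x ≐ a /p^ 0
  ι-≐ x≈a = refl , x≈a

  0Q-≐ : 0Q ≐ 0 /p^ 0
  0Q-≐ = ι-≐ (fromℕ-≈ℕ 0)

  +Q-≐ : ∀ {u v a b e f} → u ≐ a /p^ e → v ≐ b /p^ f → u +Q v ≐ p ^ f * a + p ^ e * b /p^ (e + f)
  +Q-≐ {_ /p^ e} {_ /p^ f} (refl , u≈) (refl , v≈) =
    refl , +ℤ-≈ℕ (*ℤ-≈ℕ (fromℕ-≈ℕ (p ^ f)) u≈) (*ℤ-≈ℕ (fromℕ-≈ℕ (p ^ e)) v≈)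

  *Q-≐ : ∀ {u v a b e f} → u ≐ a /p^ e → v ≐ b /p^ f → u *Q v ≐ a * b /p^ (e + f)
  *Q-≐ {_ /p^ _} {_ /p^ _} (refl , u≈) (refl , v≈) = refl , *ℤ-≈ℕ u≈ v≈

  pReLU-≐-integral : ∀ {u} b e → u ≐ b * p ^ e /p^ e → pReLU u ≐ b /p^ 0
  pReLU-≐-integral {x /p^ _} b e (refl , x≈)
    rewrite trans (x≈ e) (m*n%n≡0 b (p ^ e) {{m^n≢0 p e}}) = ι-≐ (shiftL-≈ℕ b e x≈)

  pReLU-≐-nonintegral : ∀ {u a e} → u ≐ a /p^ e → a %p^ e ≢ 0 → pReLU u ≐ 0 /p^ 0
  pReLU-≐-nonintegral {x /p^ e} (refl , x≈) a≢0 with res x e | x≈ e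
  ... | zero  | 0≡a = contradiction (sym 0≡a) a≢0
  ... | suc _ | _   = 0Q-≐

  pReLU-≐-1/p : 1 < p → ∀ {u} k → u ≐ 1 + k * p ^ 1 /p^ 1 → pReLU u ≐ 0 /p^ 0
  pReLU-≐-1/p 1<p k u≐ = pReLU-≐-nonintegral u≐ λ ≡0 → contradiction (begin
      1                       ≡⟨ sym (m<n⇒m%n≡m (subst (1 <_) (sym (*-identityʳ p)) 1<p)) ⟩
      1 %p^ 1                 ≡⟨ sym ([m+kn]%n≡m%n 1 k (p ^ 1)) ⟩
      (1 + k * p ^ 1) %p^ 1   ≡⟨ ≡0 ⟩
      0                       ∎) λ ()
    where open ≡-Reasoning
          instance _ = m^n≢0 p 1

  exp-pReLU : ∀ u → exp (pReLU u) ≡ 0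
  exp-pReLU (x /p^ e) with res x e ≡ᵇ 0
  ... | true  = refl
  ... | false = refl

  exp-sumQ : ∀ n (g : Fin n → ℚp) → (∀ j → exp (g j) ≡ 0) → exp (sumQ n g) ≡ 0
  exp-sumQ zero    g _ = refl
  exp-sumQ (suc n) g h = cong₂ _+_ (h zero) (exp-sumQ n (λ j → g (suc j)) (λ j → h (suc j)))

  ≈Q-ι-num : ∀ u → exp u ≡ 0 → u ≈Q ι (num u)
  ≈Q-ι-num (_ /p^ _) refl _ = refl

  oneQ : ℚp
  oneQ = ι (fromℕ 1)

  p⁻¹ : ℚp
  p⁻¹ = fromℕ 1 /p^ 1

  oneQ-≐ : oneQ ≐ 1 /p^ 0
  oneQ-≐ = ι-≐ (fromℕ-≈ℕ 1)

  p⁻¹-≐ : p⁻¹ ≐ 1 /p^ 1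
  p⁻¹-≐ = refl , fromℕ-≈ℕ 1

  diagonal : ∀ {n} → ℚp → Fin n → Fin n → ℚp
  diagonal w zero    zero    = w
  diagonal w zero    (suc j) = 0Q
  diagonal w (suc i) zero    = 0Q
  diagonal w (suc i) (suc j) = diagonal w i j

  exp-diagonal : ∀ {n w} → exp w ≡ 0 → (i j : Fin n) → exp (diagonal w i j) ≡ 0
  exp-diagonal w₀ zero    zero    = w₀
  exp-diagonal w₀ zero    (suc j) = refl
  exp-diagonal w₀ (suc i) zero    = refl
  exp-diagonal w₀ (suc i) (suc j) = exp-diagonal w₀ i j

  sumQ-0Q*-≐ : ∀ n {v : Fin n → ℚp} {a : Fin n → ℕ} → (∀ j → v j ≐ a j /p^ 0) →
               sumQ n (λ j → 0Q *Q v j) ≐ 0 /p^ 0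
  sumQ-0Q*-≐ zero    v≐ = 0Q-≐
  sumQ-0Q*-≐ (suc n) v≐ = +Q-≐ (*Q-≐ 0Q-≐ (v≐ zero)) (sumQ-0Q*-≐ n (λ j → v≐ (suc j)))

  sumQ-diagonal-≐ : ∀ {w e} → w ≐ 1 /p^ e → ∀ n (i : Fin n) {v : Fin n → ℚp} {a : Fin n → ℕ} →
                    (∀ j → v j ≐ a j /p^ 0) → sumQ n (λ j → diagonal w i j *Q v j) ≐ a i /p^ e
  sumQ-diagonal-≐ {e = e} w≐ (suc n) zero {a = a} v≐ =
    ≐-cong eq (trans (+-identityʳ (e + 0)) (+-identityʳ e))
      (+Q-≐ (*Q-≐ w≐ (v≐ zero)) (sumQ-0Q*-≐ n (λ j → v≐ (suc j))))
    where eq : p ^ 0 * (1 * a zero) + p ^ (e + 0) * 0 ≡ a zero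
          eq = solve 2 (λ P a → con 1 :* (con 1 :* a) :+ P :* con 0 := a) refl (p ^ (e + 0)) (a zero)
  sumQ-diagonal-≐ {e = e} w≐ (suc n) (suc i) {a = a} v≐ =
    ≐-cong eq refl (+Q-≐ (*Q-≐ 0Q-≐ (v≐ zero)) (sumQ-diagonal-≐ w≐ n i (λ j → v≐ (suc j))))
    where eq : p ^ e * 0 + p ^ 0 * a (suc i) ≡ a (suc i)
          eq = cong₂ _+_ (*-zeroʳ (p ^ e)) (*-identityˡ (a (suc i)))

  applyAff-diagonal-≐ : ∀ {n w e} {c v : Fin n → ℚp} {a : Fin n → ℕ} {b} i →
                        w ≐ 1 /p^ e → c i ≐ b /p^ 0 → (∀ j → v j ≐ a j /p^ 0) →
                        applyAff (affine (diagonal w) c) v i ≐ a i + p ^ e * b /p^ e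
  applyAff-diagonal-≐ {n} {e = e} {a = a} {b} i w≐ cᵢ≐ v≐ =
    ≐-cong (cong (_+ p ^ e * b) (*-identityˡ (a i))) (+-identityʳ e)
      (+Q-≐ (sumQ-diagonal-≐ w≐ n i v≐) cᵢ≐)

module BaseDigits (q : ℕ) .{{q≢0 : NonZero q}} where

  digit : ∀ {n} → Fin n → ℕ → ℕ
  digit zero    t = t % q
  digit (suc i) t = digit i (t / q)

  fromDigits : ∀ n → (Fin n → ℕ) → ℕ
  fromDigits zero    r = 0
  fromDigits (suc n) r = r zero + fromDigits n (λ j → r (suc j)) * q

  digit-fromDigits : ∀ n (r : Fin n → ℕ) → (∀ j → r j < q) → ∀ i → digit i (fromDigits n r) ≡ r i
  digit-fromDigits (suc n) r r<q zero    = begin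
      (r zero + rest * q) % q  ≡⟨ [m+kn]%n≡m%n (r zero) rest q ⟩
      r zero % q               ≡⟨ m<n⇒m%n≡m (r<q zero) ⟩
      r zero                   ∎
    where open ≡-Reasoning
          rest = fromDigits n (λ j → r (suc j))
  digit-fromDigits (suc n) r r<q (suc i) = begin
      digit i ((r zero + rest * q) / q)
        ≡⟨ cong (digit i) (+-distrib-/-∣ʳ (r zero) (n∣m*n rest)) ⟩
      digit i (r zero / q + rest * q / q)
        ≡⟨ cong₂ (λ u v → digit i (u + v)) (m<n⇒m/n≡0 (r<q zero)) (m*n/n≡m rest q) ⟩
      digit i rest
        ≡⟨ digit-fromDigits n (λ j → r (suc j)) (λ j → r<q (suc j)) i ⟩
      r (suc i) ∎
    where open ≡-Reasoning
          rest = fromDigits n (λ j → r (suc j))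

  fromDigits<q^ : ∀ n (r : Fin n → ℕ) → (∀ j → r j < q) → fromDigits n r < q ^ n
  fromDigits<q^ zero    r r<q = s≤s z≤n
  fromDigits<q^ (suc n) r r<q = begin-strict
      r zero + rest * q  <⟨ +-monoˡ-< (rest * q) (r<q zero) ⟩
      q + rest * q       ≡⟨ *-comm (suc rest) q ⟩
      q * suc rest       ≤⟨ *-monoʳ-≤ q (fromDigits<q^ n (λ j → r (suc j)) (λ j → r<q (suc j))) ⟩
      q * q ^ n          ∎
    where open ≤-Reasoning
          rest = fromDigits n (λ j → r (suc j))

module Decoder (p : ℕ) .{{p≢0 : NonZero p}} (1<p : 1 < p) (d m : ℕ) where
  open Padic p
  open PadicResidues p
  open PadicFractions p

  q : ℕ
  q = p ^ m

  instance
    q≢0 : NonZero q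
    q≢0 = m^n≢0 p m

  open BaseDigits q

  -- (q ∸ 1) * digit i s ≡ - digit i s modulo q, so the sums of biases telescope (biasSum-suc).
  bias : Fin d → ℕ → ℕ
  bias i zero    = digit i 0
  bias i (suc s) = digit i (suc s) + (q ∸ 1) * digit i s

  biasSum : Fin d → ℕ → ℕ
  biasSum i zero    = 0
  biasSum i (suc s) = bias i s + biasSum i s

  digitSum : Fin d → ℕ → ℕ
  digitSum i zero    = 0
  digitSum i (suc t) = digit i t + digitSum i t

  biasSum-suc : ∀ i t → biasSum i (suc t) ≡ digit i t + digitSum i t * q
  biasSum-suc i zero    = refl
  biasSum-suc i (suc t) = begin
      A + Q * B + biasSum i (suc t)  ≡⟨ cong (A + Q * B +_) (biasSum-suc i t) ⟩
      A + Q * B + (B + C * q)        ≡⟨ cong (λ x → A + Q * B + (B + C * x)) (sym 1+Q≡q) ⟩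
      A + Q * B + (B + C * (1 + Q))
        ≡⟨ solve 4 (λ A Q B C → A :+ Q :* B :+ (B :+ C :* (con 1 :+ Q)) := A :+ (B :+ C) :* (con 1 :+ Q))
             refl A Q B C ⟩
      A + (B + C) * (1 + Q)          ≡⟨ cong (λ x → A + (B + C) * x) 1+Q≡q ⟩
      A + (B + C) * q                ∎
    where
      open ≡-Reasoning
      A = digit i (suc t)
      B = digit i t
      C = digitSum i t
      Q = q ∸ 1
      1+Q≡q : 1 + Q ≡ q
      1+Q≡q = m+[n∸m]≡n (>-nonZero⁻¹ q)

  broadcast : Affine 1 d
  broadcast = affine (λ _ _ → oneQ) (λ _ → 0Q)

  step : ℕ → Affine d d
  step s = affine (diagonal p⁻¹) (λ i → ι (fromℕ (p ^ s * bias i s)))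

  readout : Affine d d
  readout = affine (diagonal oneQ) (λ _ → 0Q)

  steps : ℕ → Net d d
  steps zero    = output readout
  steps (suc s) = hidden (step s) (steps s)

  decoder : ℕ → Net 1 d
  decoder k = hidden broadcast (steps k)

  width-decoder : ∀ k → width (decoder k) ≡ d
  width-decoder k = d⊔width-steps k
    where
      d⊔width-steps : ∀ s → d ⊔ width (steps s) ≡ d
      d⊔width-steps zero    = ⊔-identityʳ d
      d⊔width-steps (suc s) = begin
        d ⊔ (d ⊔ width (steps s))  ≡⟨ sym (⊔-assoc d d (width (steps s))) ⟩
        d ⊔ d ⊔ width (steps s)    ≡⟨ cong (_⊔ width (steps s)) (⊔-idem d) ⟩
        d ⊔ width (steps s)        ≡⟨ d⊔width-steps s ⟩
        d                          ∎
        where open ≡-Reasoning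

  exp-decoder : ∀ k x i → exp (eval (decoder k) (λ _ → ι x) i) ≡ 0
  exp-decoder k x = exp-steps k (λ j → exp-pReLU (applyAff broadcast (λ _ → ι x) j))
    where
      exp-steps : ∀ s {v : Fin d → ℚp} → (∀ j → exp (v j) ≡ 0) → ∀ i → exp (eval (steps s) v i) ≡ 0
      exp-steps zero    {v} v₀ i = trans (+-identityʳ _)
        (exp-sumQ d (λ j → diagonal oneQ i j *Q v j) (λ j → cong₂ _+_ (exp-diagonal refl i j) (v₀ j)))
      exp-steps (suc s) {v} v₀ = exp-steps s (λ j → exp-pReLU (applyAff (step s) v j))

  broadcast-≐ : ∀ {x a} → x ≈ℕ a → ∀ i → applyAff broadcast (λ _ → ι x) i ≐ a /p^ 0
  broadcast-≐ {a = a} x≈a i =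
    ≐-cong eq refl (+Q-≐ (+Q-≐ (*Q-≐ oneQ-≐ (ι-≐ x≈a)) 0Q-≐) 0Q-≐)
    where eq : p ^ 0 * (p ^ 0 * (1 * a) + p ^ 0 * 0) + p ^ 0 * 0 ≡ a
          eq = solve 1 (λ a → con 1 :* (con 1 :* (con 1 :* a) :+ con 1 :* con 0) :+ con 1 :* con 0 := a) refl a

  step-≐ : ∀ s {v : Fin d → ℚp} {a : Fin d → ℕ} → (∀ j → v j ≐ a j /p^ 0) →
           ∀ i → applyAff (step s) v i ≐ a i + p ^ 1 * (p ^ s * bias i s) /p^ 1
  step-≐ s v≐ i =
    applyAff-diagonal-≐ {c = λ j → ι (fromℕ (p ^ s * bias j s))} i p⁻¹-≐ (ι-≐ (fromℕ-≈ℕ _)) v≐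

  pReLU-step-≐ : ∀ s {v : Fin d → ℚp} {a : Fin d → ℕ} → (∀ j → v j ≐ a j /p^ 0) →
                 ∀ {i} b → a i + p ^ 1 * (p ^ s * bias i s) ≡ b * p ^ 1 →
                 pReLU (applyAff (step s) v i) ≐ b /p^ 0
  pReLU-step-≐ s v≐ {i} b eq = pReLU-≐-integral b 1 (≐-cong eq refl (step-≐ s v≐ i))

  steps-accumulate : ∀ s (c : Fin d → ℕ) {v : Fin d → ℚp} → (∀ j → v j ≐ p ^ s * c j /p^ 0) →
                     ∀ i → eval (steps s) v i ≐ c i + biasSum i s /p^ 0
  steps-accumulate zero    c v≐ i =
    ≐-cong (solve 1 (λ c → con 1 :* c :+ con 1 :* con 0 := c :+ con 0) refl (c i)) refl
      (applyAff-diagonal-≐ i oneQ-≐ 0Q-≐ v≐)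
  steps-accumulate (suc s) c v≐ i =
    ≐-cong (+-assoc (c i) (bias i s) (biasSum i s)) refl
      (steps-accumulate s (λ j → c j + bias j s) (λ j → pReLU-step-≐ s v≐ _ (eq j)) i)
    where
      eq : ∀ j → p ^ suc s * c j + p ^ 1 * (p ^ s * bias j s) ≡ p ^ s * (c j + bias j s) * p ^ 1
      eq j = solve 4 (λ p P c b → p :* P :* c :+ p :* con 1 :* (P :* b) := P :* (c :+ b) :* (p :* con 1))
               refl p (p ^ s) (c j) (bias j s)

  steps-countdown : ∀ J s (c : Fin d → ℕ) {v : Fin d → ℚp} →
                    (∀ j → v j ≐ p ^ J + p ^ suc (J + s) * c j /p^ 0) →
                    ∀ i → eval (steps (suc (J + s))) v i ≐ biasSum i s /p^ 0
  steps-countdown zero    s c v≐ =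
    steps-accumulate s (λ _ → 0) λ j →
      ≐-cong (sym (*-zeroʳ (p ^ s))) refl
        (pReLU-≐-1/p 1<p (p ^ s * (c j + bias j s)) (≐-cong (eq j) refl (step-≐ s v≐ j)))
    where
      eq : ∀ j → p ^ 0 + p ^ suc s * c j + p ^ 1 * (p ^ s * bias j s)
               ≡ 1 + p ^ s * (c j + bias j s) * p ^ 1
      eq j = solve 4 (λ p P c b → con 1 :+ p :* P :* c :+ p :* con 1 :* (P :* b)
                                    := con 1 :+ P :* (c :+ b) :* (p :* con 1))
               refl p (p ^ s) (c j) (bias j s)
  steps-countdown (suc J) s c v≐ =
    steps-countdown J s (λ j → c j + b j) (λ j → pReLU-step-≐ (suc (J + s)) v≐ _ (eq j))
    where
      b : Fin d → ℕ
      b j = bias j (suc (J + s))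
      eq : ∀ j → p ^ suc J + p ^ suc (suc J + s) * c j + p ^ 1 * (p ^ suc (J + s) * b j)
               ≡ (p ^ J + p ^ suc (J + s) * (c j + b j)) * p ^ 1
      eq j = solve 5 (λ p A B c b → p :* A :+ p :* B :* c :+ p :* con 1 :* (B :* b)
                                      := (A :+ B :* (c :+ b)) :* (p :* con 1))
               refl p (p ^ J) (p ^ suc (J + s)) (c j) (b j)

  decoder-on-p^ : ∀ {k} J s → suc (J + s) ≡ k →
                  ∀ i → eval (decoder k) (λ _ → ι (fromℕ (p ^ J))) i ≐ biasSum i s /p^ 0
  decoder-on-p^ J s refl = steps-countdown J s (λ _ → 0) λ j →
    ≐-cong (sym (trans (cong (p ^ J +_) (*-zeroʳ (p ^ suc (J + s)))) (+-identityʳ (p ^ J)))) refl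
      (pReLU-≐-integral (p ^ J) 0
        (≐-cong (sym (*-identityʳ (p ^ J))) refl (broadcast-≐ (fromℕ-≈ℕ (p ^ J)) j)))

  K : ℕ
  K = suc (suc (q ^ d))

  -- Opaque because ℤp is a function type: comparing two non-identical occurrences of decoding would
  -- eta-expand them and evaluate the whole network digit by digit.
  opaque
    decoding : ℤp → Fin d → ℤp
    decoding x i = num (eval (decoder K) (λ _ → ι x) i)

    decoder-computes : Computes (decoder K) decoding
    decoder-computes x i = ≈Q-ι-num (eval (decoder K) (λ _ → ι x) i) (exp-decoder K x i)

    decoding-on-p^ : ∀ J s → suc (J + s) ≡ K → ∀ i → decoding (fromℕ (p ^ J)) i ≈ℕ biasSum i s
    decoding-on-p^ J s J+s+1≡K i = proj₂ (decoder-on-p^ J s J+s+1≡K i)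

  decoding-hits-residues : ∀ (y : Fin d → ℤp) → ∃ λ x → ∀ i → res (y i) m ≡ res (decoding x i) m
  decoding-hits-residues y = fromℕ (p ^ J) , hit
    where
      r : Fin d → ℕ
      r i = res (y i) m
      r<q : ∀ i → r i < q
      r<q i = res<p^ (y i) m
      t = fromDigits d r
      J = q ^ d ∸ t
      J+t+2≡K : suc (J + suc t) ≡ K
      J+t+2≡K = cong suc (trans (+-suc J t) (cong suc (m∸n+n≡m (<⇒≤ (fromDigits<q^ d r r<q)))))
      hit : ∀ i → res (y i) m ≡ res (decoding (fromℕ (p ^ J)) i) m
      hit i = begin
        r i                                 ≡⟨ sym (res%p^ (y i) m) ⟩
        r i % q                             ≡⟨ cong (_% q) (sym (digit-fromDigits d r r<q i)) ⟩
        digit i t % q                       ≡⟨ sym ([m+kn]%n≡m%n (digit i t) (digitSum i t) q) ⟩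
        (digit i t + digitSum i t * q) % q  ≡⟨ cong (_% q) (sym (biasSum-suc i t)) ⟩
        biasSum i (suc t) % q               ≡⟨ sym (decoding-on-p^ J (suc t) J+t+2≡K i m) ⟩
        res (decoding (fromℕ (p ^ J)) i) m  ∎
        where open ≡-Reasoning

lemma3p19 : (p : ℕ) → (pr : Prime p) → (d m : ℕ) → 1 ≤ d → 1 ≤ m →
    let open Padic p {{prime⇒nonZero pr}} in
    ∃ λ (N : Net 1 d) → width N ≡ d ×
      ∃ λ (f : ℤp → Fin d → ℤp) → Computes N f × IsDecoding d m f
lemma3p19 p pr d m _ _ =
  decoder K , width-decoder K , decoding , decoder-computes ,
  res-surjective⇒IsDecoding d m decoding decoding-hits-residues
  where open Decoder p {{prime⇒nonZero pr}} (nonTrivial⇒n>1 p {{prime⇒nonTrivial pr}}) d m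
        open PadicResidues p {{prime⇒nonZero pr}}
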